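{- Let $L/K$ be an unramified quadratic extension, $n\ge1$ and $0\le d<n$. For $u_1,u_2\in\mathcal{O}_{n-d}^*$, the lattices $u_1\mathcal{O}_n$ and $u_2\mathcal{O}_n$ represent the same vertex of the Bruhat–Tits tree of $SL(2,K)$ (i.e. are homothetic by an element of $K^*$) if and only if $u_1u_2^{ -1}\in\mathcal{O}_n^*$. In particular, if $u_1,\dots,u_l$ is a set of representatives of $\mathcal{O}_{n-d}^*/\mathcal{O}_n^*$, then $u_1\mathcal{O}_n,\dots,u_l\mathcal{O}_n$ represent pairwise distinct vertices.
   Context: $K$ is a nonarchimedean local field of characteristic zero with ring of integers $\mathcal{O}_K$ and uniformizer $p$; $\mathcal{O}_L=\mathcal{O}_K[\Delta]$ is the ring of integers of $L$ (e.g. $\Delta=\sqrt{\epsilon}$ with $\epsilon$ a nonsquare unit of $\mathcal{O}_K$), and $\mathcal{O}_n=\mathcal{O}_K[p^n\Delta]$, with unit group $\mathcal{O}_n^*$. Vertices of the tree are $K^*$-homothety classes of $\mathcal{O}_K$-lattices in $L$. -}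

module Defs where

open import Level using (Level; _⊔_) renaming (suc to lsuc)
open import Algebra.Bundles using (CommutativeRing)
open import Data.Nat using (ℕ; zero; suc)
open import Data.Fin using (Fin)
open import Data.Product using (Σ; ∃; _×_; _,_)
open import Data.Sum using (_⊎_)
open import Relation.Nullary using (¬_)
open import Relation.Binary.PropositionalEquality using (_≡_)

module RingAux {c ℓ : Level} (R : CommutativeRing c ℓ) where
  open CommutativeRing R

  pow : Carrier → ℕ → Carrier
  pow x zero    = 1#
  pow x (suc n) = x * pow x n

  nat : ℕ → Carrier
  nat zero    = 0#
  nat (suc n) = 1# + nat n

  Unit : (Carrier → Set ℓ) → Carrier → Set (c ⊔ ℓ)
  Unit 𝒪 x = 𝒪 x × ∃ λ y → 𝒪 y × (x * y ≈ 1#)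

  InPow : (Carrier → Set ℓ) → Carrier → Carrier → ℕ → Set (c ⊔ ℓ)
  InPow 𝒪 p x n = ∃ λ y → 𝒪 y × (x ≈ pow p n * y)

-- A nonarchimedean local field K of characteristic zero, presented through
-- its ring of integers 𝒪 (a predicate on K) and a uniformizer p.
record NALocalField (c ℓ : Level) : Set (lsuc (c ⊔ ℓ)) where
  field
    cring : CommutativeRing c ℓ
  open CommutativeRing cring public
  open RingAux cring public

  field
    0≉1     : ¬ (0# ≈ 1#)
    inverse : ∀ x → ¬ (x ≈ 0#) → ∃ λ y → x * y ≈ 1#
    char0   : ∀ n → ¬ (nat (suc n) ≈ 0#)
    𝒪       : Carrier → Set ℓ
    𝒪-resp  : ∀ {x y} → x ≈ y → 𝒪 x → 𝒪 y
    𝒪-0     : 𝒪 0#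
    𝒪-1     : 𝒪 1#
    𝒪-+     : ∀ {x y} → 𝒪 x → 𝒪 y → 𝒪 (x + y)
    𝒪-neg   : ∀ {x} → 𝒪 x → 𝒪 (- x)
    𝒪-*     : ∀ {x y} → 𝒪 x → 𝒪 y → 𝒪 (x * y)
    p       : Carrier
    𝒪-p     : 𝒪 p
    p≉0     : ¬ (p ≈ 0#)
    p-nonunit : ∀ y → 𝒪 y → ¬ (p * y ≈ 1#)
    -- discrete valuation: every nonzero x is p^k·u or p^{-k}·u with u ∈ 𝒪_K^*
    valuation : ∀ x → ¬ (x ≈ 0#) → ∃ λ k → ∃ λ u → Unit 𝒪 u ×
                  ((x ≈ pow p k * u) ⊎ (pow p k * x ≈ u))
    complete  : (a : ℕ → Carrier) → (∀ n → InPow 𝒪 p (a (suc n) - a n) n) →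
                ∃ λ x → ∀ n → InPow 𝒪 p (x - a n) n
    finite-residue : ∃ λ q → Σ (Fin q → Carrier) λ f →
                     (∀ i → 𝒪 (f i)) ×
                     (∀ a → 𝒪 a → ∃ λ i → InPow 𝒪 p (a - f i) 1)

  𝒪ˣ : Carrier → Set (c ⊔ ℓ)
  𝒪ˣ = Unit 𝒪

  _∈p^_𝒪 : Carrier → ℕ → Set (c ⊔ ℓ)
  x ∈p^ n 𝒪 = InPow 𝒪 p x n

-- The quadratic extension L = K(Δ), Δ² = t·Δ + s, with t, s ∈ 𝒪_K.
-- It is unramified with 𝒪_L = 𝒪_K[Δ] exactly when X² - tX - s is
-- irreducible modulo p (no root in the residue field).
module _ {c ℓ : Level} (K : NALocalField c ℓ) where
  open NALocalField K

  UnramifiedData : Carrier → Carrier → Set (c ⊔ ℓ)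
  UnramifiedData t s = 𝒪 t × 𝒪 s ×
    (∀ a → 𝒪 a → ¬ (((a * a) - (t * a) - s) ∈p^ 1 𝒪))

module Ext {c ℓ : Level} (K : NALocalField c ℓ) (t s : NALocalField.Carrier K) where
  open NALocalField K

  -- elements a + bΔ of L
  L : Set c
  L = Carrier × Carrier

  infix 4 _≈L_
  infixl 7 _*L_

  _≈L_ : L → L → Set ℓ
  (a , b) ≈L (a' , b') = (a ≈ a') × (b ≈ b')

  -- (a + bΔ)(c + dΔ) = ac + bd s + (ad + bc + bd t)Δ
  _*L_ : L → L → L
  (a , b) *L (a' , b') = ((a * a') + ((b * b') * s)) , (((a * b') + (b * a')) + ((b * b') * t))

  1L : L
  1L = 1# , 0#

  ι : Carrier → L
  ι x = x , 0#

  -- 𝒪_n = 𝒪_K[p^n Δ] = { a + b Δ : a ∈ 𝒪_K, b ∈ p^n 𝒪_K }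
  𝒪[_] : ℕ → L → Set (c ⊔ ℓ)
  𝒪[ n ] (a , b) = 𝒪 a × (b ∈p^ n 𝒪)

  𝒪[_]ˣ : ℕ → L → Set (c ⊔ ℓ)
  𝒪[ n ]ˣ u = 𝒪[ n ] u × ∃ λ v → 𝒪[ n ] v × (u *L v ≈L 1L)

  _∈_·𝒪[_] : L → L → ℕ → Set (c ⊔ ℓ)
  x ∈ u ·𝒪[ n ] = ∃ λ y → 𝒪[ n ] y × (x ≈L (u *L y))

  SameVertex : ℕ → L → L → Set (c ⊔ ℓ)
  SameVertex n u₁ u₂ = ∃ λ μ → ¬ (μ ≈ 0#) ×
    (∀ x → (x ∈ u₁ ·𝒪[ n ] → x ∈ (ι μ *L u₂) ·𝒪[ n ]) ×
           (x ∈ (ι μ *L u₂) ·𝒪[ n ] → x ∈ u₁ ·𝒪[ n ]))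

  -- u₁ u₂⁻¹ ∈ 𝒪_n^*  (u₂⁻¹ its inverse in L)
  QuotUnit : ℕ → L → L → Set (c ⊔ ℓ)
  QuotUnit n u₁ u₂ = ∀ v → (u₂ *L v) ≈L 1L → 𝒪[ n ]ˣ (u₁ *L v)

  Representatives : ℕ → ℕ → (l : ℕ) → (Fin l → L) → Set (c ⊔ ℓ)
  Representatives m n l u =
    (∀ i → 𝒪[ m ]ˣ (u i)) ×
    (∀ i j → QuotUnit n (u i) (u j) → i ≡ j) ×
    (∀ w → 𝒪[ m ]ˣ w → ∃ λ i → QuotUnit n w (u i))

module Submission where

open import Defs
open import Data.Nat using (ℕ; zero; suc; _≤_; _<_; _∸_)
open import Data.Fin using (Fin)
open import Data.Product using (_×_; _,_; proj₁; proj₂; ∃)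
open import Relation.Nullary using (¬_)
open import Relation.Binary.PropositionalEquality using (_≡_)
open import Function.Bundles using (_⇔_; mk⇔)

open import Level using (Level)
open import Algebra.Bundles using (CommutativeMonoid)
open import Algebra.Definitions using (Congruent₂; Associative; Commutative; LeftIdentity)
open import Algebra.Structures using (IsCommutativeMonoid)
open import Algebra.Structures.Biased using (isCommutativeMonoidˡ)
open import Relation.Binary.Structures using (IsEquivalence)
import Algebra.Properties.CommutativeSemigroup as CommSemigroupProperties
import Algebra.Solver.Ring.NaturalCoefficients.Default as RingSolver
import Relation.Binary.Reasoning.Setoid as SetoidReasoning

-- Suppose u₁𝒪_n = μ·u₂𝒪_n. Comparing generators gives u₁ = μu₂y and μu₂ = u₁z
-- with y, z ∈ 𝒪_n. As u₁, u₂ are units of 𝒪_L, the first equation makes μ⁻¹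
-- integral and the second makes μ integral, so μ ∈ 𝒪_K^*. Then u₁u₂⁻¹ = μy lies
-- in 𝒪_n and has the inverse μ⁻¹z ∈ 𝒪_n. Conversely, if w = u₁u₂⁻¹ ∈ 𝒪_n^* then
-- u₁𝒪_n = u₂w𝒪_n = u₂𝒪_n.

module UniformizerPowers {c ℓ : Level} (K : NALocalField c ℓ) where
  open NALocalField K
  open CommSemigroupProperties *-commutativeSemigroup using (x∙yz≈y∙xz)

  pow-𝒪 : ∀ n → 𝒪 (pow p n)
  pow-𝒪 zero    = 𝒪-1
  pow-𝒪 (suc n) = 𝒪-* 𝒪-p (pow-𝒪 n)

  module Ideal (n : ℕ) where

    ∈p^-resp : ∀ {x y} → x ≈ y → x ∈p^ n 𝒪 → y ∈p^ n 𝒪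
    ∈p^-resp x≈y (z , 𝒪z , x≈pⁿz) = z , 𝒪z , trans (sym x≈y) x≈pⁿz

    ∈p^-0 : 0# ∈p^ n 𝒪
    ∈p^-0 = 0# , 𝒪-0 , sym (zeroʳ _)

    ∈p^-+ : ∀ {x y} → x ∈p^ n 𝒪 → y ∈p^ n 𝒪 → (x + y) ∈p^ n 𝒪
    ∈p^-+ (z , 𝒪z , x≈) (z' , 𝒪z' , y≈) =
      z + z' , 𝒪-+ 𝒪z 𝒪z' , trans (+-cong x≈ y≈) (sym (distribˡ _ _ _))

    ∈p^-*ˡ : ∀ {a x} → 𝒪 a → x ∈p^ n 𝒪 → (a * x) ∈p^ n 𝒪
    ∈p^-*ˡ {a} 𝒪a (z , 𝒪z , x≈) =
      a * z , 𝒪-* 𝒪a 𝒪z , trans (*-cong refl x≈) (x∙yz≈y∙xz a _ z)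

    ∈p^-*ʳ : ∀ {a x} → x ∈p^ n 𝒪 → 𝒪 a → (x * a) ∈p^ n 𝒪
    ∈p^-*ʳ {a} (z , 𝒪z , x≈) 𝒪a =
      z * a , 𝒪-* 𝒪z 𝒪a , trans (*-cong x≈ refl) (*-assoc _ z a)

    ∈p^⇒𝒪 : ∀ {x} → x ∈p^ n 𝒪 → 𝒪 x
    ∈p^⇒𝒪 (z , 𝒪z , x≈) = 𝒪-resp (sym x≈) (𝒪-* (pow-𝒪 n) 𝒪z)

  𝒪⇒∈p^0 : ∀ {x} → 𝒪 x → x ∈p^ 0 𝒪
  𝒪⇒∈p^0 {x} 𝒪x = x , 𝒪x , sym (*-identityˡ x)

module QuadraticAlgebra {c ℓ : Level} (K : NALocalField c ℓ) (t s : NALocalField.Carrier K) where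
  open NALocalField K
  open Ext K t s
  private module Solver = RingSolver commutativeSemiring

  ≈L-isEquivalence : IsEquivalence _≈L_
  ≈L-isEquivalence = record
    { refl  = refl , refl
    ; sym   = λ (a≈ , b≈) → sym a≈ , sym b≈
    ; trans = λ (a≈ , b≈) (a≈' , b≈') → trans a≈ a≈' , trans b≈ b≈'
    }

  *L-cong : Congruent₂ _≈L_ _*L_
  *L-cong (a≈ , b≈) (a≈' , b≈') =
    +-cong (*-cong a≈ a≈') (*-cong (*-cong b≈ b≈') refl) ,
    +-cong (+-cong (*-cong a≈ b≈') (*-cong b≈ a≈')) (*-cong (*-cong b≈ b≈') refl)

  *L-assoc : Associative _≈L_ _*L_
  *L-assoc (a , b) (a' , b') (a'' , b'') =
    solve 8 (λ a b a' b' a'' b'' s t →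
      (((a :* a') :+ ((b :* b') :* s)) :* a'')
        :+ (((((a :* b') :+ (b :* a')) :+ ((b :* b') :* t)) :* b'') :* s)
      := (a :* ((a' :* a'') :+ ((b' :* b'') :* s)))
        :+ ((b :* (((a' :* b'') :+ (b' :* a'')) :+ ((b' :* b'') :* t))) :* s))
      refl a b a' b' a'' b'' s t ,
    solve 8 (λ a b a' b' a'' b'' s t →
      ((((a :* a') :+ ((b :* b') :* s)) :* b'')
        :+ ((((a :* b') :+ (b :* a')) :+ ((b :* b') :* t)) :* a''))
        :+ (((((a :* b') :+ (b :* a')) :+ ((b :* b') :* t)) :* b'') :* t)
      := ((a :* (((a' :* b'') :+ (b' :* a'')) :+ ((b' :* b'') :* t)))
        :+ (b :* ((a' :* a'') :+ ((b' :* b'') :* s))))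
        :+ ((b :* (((a' :* b'') :+ (b' :* a'')) :+ ((b' :* b'') :* t))) :* t))
      refl a b a' b' a'' b'' s t
    where open Solver

  *L-comm : Commutative _≈L_ _*L_
  *L-comm (a , b) (a' , b') =
    solve 5 (λ a b a' b' s → (a :* a') :+ ((b :* b') :* s) := (a' :* a) :+ ((b' :* b) :* s))
      refl a b a' b' s ,
    solve 5 (λ a b a' b' t →
      ((a :* b') :+ (b :* a')) :+ ((b :* b') :* t) := ((a' :* b) :+ (b' :* a)) :+ ((b' :* b) :* t))
      refl a b a' b' t
    where open Solver

  *L-identityˡ : LeftIdentity _≈L_ 1L _*L_
  *L-identityˡ (a , b) =
    solve 3 (λ a b s → (con 1 :* a) :+ ((con 0 :* b) :* s) := a) refl a b s ,
    solve 3 (λ a b t → ((con 1 :* b) :+ (con 0 :* a)) :+ ((con 0 :* b) :* t) := b) refl a b t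
    where open Solver

  *L-isCommutativeMonoid : IsCommutativeMonoid _≈L_ _*L_ 1L
  *L-isCommutativeMonoid = isCommutativeMonoidˡ record
    { isSemigroup = record
      { isMagma = record { isEquivalence = ≈L-isEquivalence ; ∙-cong = *L-cong }
      ; assoc   = *L-assoc
      }
    ; identityˡ = *L-identityˡ
    ; comm      = *L-comm
    }

  *L-commutativeMonoid : CommutativeMonoid c ℓ
  *L-commutativeMonoid = record { isCommutativeMonoid = *L-isCommutativeMonoid }

  proj₁-ι-*L : ∀ μ x → proj₁ (ι μ *L x) ≈ μ * proj₁ x
  proj₁-ι-*L μ (a , b) =
    solve 4 (λ μ a b s → (μ :* a) :+ ((con 0 :* b) :* s) := μ :* a) refl μ a b s
    where open Solver

  ι-*L-ι : ∀ a b → ι a *L ι b ≈L ι (a * b)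
  ι-*L-ι a b =
    solve 3 (λ a b s → (a :* b) :+ ((con 0 :* con 0) :* s) := a :* b) refl a b s ,
    solve 3 (λ a b t → ((a :* con 0) :+ (con 0 :* b)) :+ ((con 0 :* con 0) :* t) := con 0)
      refl a b t
    where open Solver

module Orders {c ℓ : Level} (K : NALocalField c ℓ) (t s : NALocalField.Carrier K)
              (𝒪-t : NALocalField.𝒪 K t) (𝒪-s : NALocalField.𝒪 K s) where
  open NALocalField K
  open Ext K t s
  open UniformizerPowers K

  module _ (n : ℕ) where
    open Ideal n

    𝒪[]-resp : ∀ {x y} → x ≈L y → 𝒪[ n ] x → 𝒪[ n ] y
    𝒪[]-resp (a≈ , b≈) (𝒪a , b∈) = 𝒪-resp a≈ 𝒪a , ∈p^-resp b≈ b∈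

    𝒪[]-* : ∀ {x y} → 𝒪[ n ] x → 𝒪[ n ] y → 𝒪[ n ] (x *L y)
    𝒪[]-* (𝒪a , b∈) (𝒪a' , b'∈) =
      𝒪-+ (𝒪-* 𝒪a 𝒪a') (𝒪-* (𝒪-* (∈p^⇒𝒪 b∈) (∈p^⇒𝒪 b'∈)) 𝒪-s) ,
      ∈p^-+ (∈p^-+ (∈p^-*ˡ 𝒪a b'∈) (∈p^-*ʳ b∈ 𝒪a')) (∈p^-*ʳ (∈p^-*ʳ b∈ (∈p^⇒𝒪 b'∈)) 𝒪-t)

    𝒪[]-ι : ∀ {μ} → 𝒪 μ → 𝒪[ n ] (ι μ)
    𝒪[]-ι 𝒪μ = 𝒪μ , ∈p^-0

  𝒪[]⊆𝒪[0] : ∀ n {x} → 𝒪[ n ] x → 𝒪[ 0 ] x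
  𝒪[]⊆𝒪[0] n (𝒪a , b∈) = 𝒪a , 𝒪⇒∈p^0 (Ideal.∈p^⇒𝒪 n b∈)

  𝒪[]ˣ⊆𝒪[0]ˣ : ∀ n {x} → 𝒪[ n ]ˣ x → 𝒪[ 0 ]ˣ x
  𝒪[]ˣ⊆𝒪[0]ˣ n (𝒪x , y , 𝒪y , xy≈1) = 𝒪[]⊆𝒪[0] n 𝒪x , y , 𝒪[]⊆𝒪[0] n 𝒪y , xy≈1

module Lattices {c ℓ : Level} (K : NALocalField c ℓ) (t s : NALocalField.Carrier K)
                (𝒪-t : NALocalField.𝒪 K t) (𝒪-s : NALocalField.𝒪 K s) where
  open NALocalField K
  open Ext K t s
  open QuadraticAlgebra K t s
  open Orders K t s 𝒪-t 𝒪-s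
  private module L = CommutativeMonoid *L-commutativeMonoid
  open import Algebra.Properties.Monoid L.monoid using (insertˡ; insertʳ; cancelʳ)
  open CommSemigroupProperties L.commutativeSemigroup using (xy∙z≈xz∙y)
  open SetoidReasoning L.setoid

  generator-∈ : ∀ n u → u ∈ u ·𝒪[ n ]
  generator-∈ n u = 1L , 𝒪[]-ι n 𝒪-1 , L.sym (L.identityʳ u)

  ∈·𝒪-trans : ∀ n {u w x} → u ∈ w ·𝒪[ n ] → x ∈ u ·𝒪[ n ] → x ∈ w ·𝒪[ n ]
  ∈·𝒪-trans n {u} {w} {x} (y' , 𝒪y' , u≈wy') (y , 𝒪y , x≈uy) = y' *L y , 𝒪[]-* n 𝒪y' 𝒪y , (begin
    x                ≈⟨ x≈uy ⟩
    u *L y           ≈⟨ L.∙-congʳ u≈wy' ⟩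
    (w *L y') *L y   ≈⟨ L.assoc w y' y ⟩
    w *L (y' *L y)   ∎)

  quotUnit⇒sameVertex : ∀ n {u₁ u₂} → (∃ λ v → u₂ *L v ≈L 1L) →
                        QuotUnit n u₁ u₂ → SameVertex n u₁ u₂
  quotUnit⇒sameVertex n {u₁} {u₂} (v , u₂v≈1) quotUnit
    with quotUnit v u₂v≈1
  ... | 𝒪w , w' , 𝒪w' , ww'≈1 =
    -- with μ = 1, the lattice μ·u₂𝒪_n has generator ι 1# *L u₂, which is 1L *L u₂
    1# , (λ 1≈0 → 0≉1 (sym 1≈0)) , λ _ → ∈·𝒪-trans n u₁∈ , ∈·𝒪-trans n u₂∈
    where
    u₁≈u₂w : u₁ ≈L u₂ *L (u₁ *L v)
    u₁≈u₂w = begin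
      u₁               ≈⟨ insertˡ u₂v≈1 u₁ ⟩
      u₂ *L (v *L u₁)  ≈⟨ L.∙-congˡ (L.comm v u₁) ⟩
      u₂ *L (u₁ *L v)  ∎
    u₁∈ : u₁ ∈ (1L *L u₂) ·𝒪[ n ]
    u₁∈ = u₁ *L v , 𝒪w , L.trans u₁≈u₂w (L.∙-congʳ (L.sym (L.identityˡ u₂)))
    u₂∈ : (1L *L u₂) ∈ u₁ ·𝒪[ n ]
    u₂∈ = w' , 𝒪w' , (begin
      1L *L u₂                     ≈⟨ L.identityˡ u₂ ⟩
      u₂                           ≈⟨ insertʳ ww'≈1 u₂ ⟩
      (u₂ *L (u₁ *L v)) *L w'      ≈⟨ L.∙-congʳ u₁≈u₂w ⟨
      u₁ *L w'                     ∎)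

  scalar-unit : ∀ n {u₁ u₂ μ} → 𝒪[ 0 ]ˣ u₁ → 𝒪[ 0 ]ˣ u₂ →
                u₁ ∈ (ι μ *L u₂) ·𝒪[ n ] → (ι μ *L u₂) ∈ u₁ ·𝒪[ n ] → 𝒪ˣ μ
  scalar-unit n {u₁} {u₂} {μ} (𝒪u₁ , v₁ , 𝒪v₁ , u₁v₁≈1) (𝒪u₂ , v₂ , 𝒪v₂ , u₂v₂≈1)
              (y , 𝒪y , u₁≈μu₂y) (z , 𝒪z , μu₂≈u₁z) =
    proj₁ (𝒪[]-resp 0 u₁zv₂≈μ (𝒪[]-* 0 (𝒪[]-* 0 𝒪u₁ (𝒪[]⊆𝒪[0] n 𝒪z)) 𝒪v₂)) ,
    proj₁ q , proj₁ 𝒪q , trans (sym (proj₁-ι-*L μ q)) (proj₁ μq≈1)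
    where
    u₁zv₂≈μ : (u₁ *L z) *L v₂ ≈L ι μ
    u₁zv₂≈μ = L.trans (L.∙-congʳ (L.sym μu₂≈u₁z)) (cancelʳ u₂v₂≈1 (ι μ))
    q : L
    q = (u₂ *L y) *L v₁
    𝒪q : 𝒪[ 0 ] q
    𝒪q = 𝒪[]-* 0 (𝒪[]-* 0 𝒪u₂ (𝒪[]⊆𝒪[0] n 𝒪y)) 𝒪v₁
    μq≈1 : ι μ *L q ≈L 1L
    μq≈1 = begin
      ι μ *L ((u₂ *L y) *L v₁)  ≈⟨ L.assoc (ι μ) (u₂ *L y) v₁ ⟨
      (ι μ *L (u₂ *L y)) *L v₁  ≈⟨ L.∙-congʳ (L.assoc (ι μ) u₂ y) ⟨
      ((ι μ *L u₂) *L y) *L v₁  ≈⟨ L.∙-congʳ u₁≈μu₂y ⟨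
      u₁ *L v₁                  ≈⟨ u₁v₁≈1 ⟩
      1L                        ∎

  unit-of-scalar-multiple : ∀ n {μ w y z} → 𝒪ˣ μ → 𝒪[ n ] y → 𝒪[ n ] z →
                            w ≈L ι μ *L y → w *L z ≈L ι μ → 𝒪[ n ]ˣ w
  unit-of-scalar-multiple n {μ = μ} {w = w} {z = z} (𝒪μ , μ' , 𝒪μ' , μμ'≈1) 𝒪y 𝒪z w≈μy wz≈μ =
    𝒪[]-resp n (L.sym w≈μy) (𝒪[]-* n (𝒪[]-ι n 𝒪μ) 𝒪y) ,
    z *L ι μ' , 𝒪[]-* n 𝒪z (𝒪[]-ι n 𝒪μ') , (begin
      w *L (z *L ι μ')    ≈⟨ L.assoc w z (ι μ') ⟨
      (w *L z) *L ι μ'    ≈⟨ L.∙-congʳ wz≈μ ⟩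
      ι μ *L ι μ'         ≈⟨ ι-*L-ι μ μ' ⟩
      ι (μ * μ')          ≈⟨ μμ'≈1 , refl ⟩
      1L                  ∎)

  sameVertex⇒quotUnit : ∀ n {u₁ u₂} → 𝒪[ 0 ]ˣ u₁ → 𝒪[ 0 ]ˣ u₂ →
                        SameVertex n u₁ u₂ → QuotUnit n u₁ u₂
  sameVertex⇒quotUnit n {u₁} {u₂} 𝒪ˣu₁ 𝒪ˣu₂ (μ , _ , sameLattice) v u₂v≈1
    with proj₁ (sameLattice u₁) (generator-∈ n u₁)
       | proj₂ (sameLattice (ι μ *L u₂)) (generator-∈ n (ι μ *L u₂))
  ... | u₁∈@(y , 𝒪y , u₁≈μu₂y) | μu₂∈@(z , 𝒪z , μu₂≈u₁z) =
    unit-of-scalar-multiple n (scalar-unit n 𝒪ˣu₁ 𝒪ˣu₂ u₁∈ μu₂∈) 𝒪y 𝒪z w≈μy wz≈μ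
    where
    w≈μy : u₁ *L v ≈L ι μ *L y
    w≈μy = begin
      u₁ *L v                    ≈⟨ L.∙-congʳ u₁≈μu₂y ⟩
      ((ι μ *L u₂) *L y) *L v    ≈⟨ L.∙-congʳ (xy∙z≈xz∙y (ι μ) u₂ y) ⟩
      ((ι μ *L y) *L u₂) *L v    ≈⟨ cancelʳ u₂v≈1 (ι μ *L y) ⟩
      ι μ *L y                   ∎
    wz≈μ : (u₁ *L v) *L z ≈L ι μ
    wz≈μ = begin
      (u₁ *L v) *L z    ≈⟨ xy∙z≈xz∙y u₁ v z ⟩
      (u₁ *L z) *L v    ≈⟨ L.∙-congʳ μu₂≈u₁z ⟨
      (ι μ *L u₂) *L v  ≈⟨ cancelʳ u₂v≈1 (ι μ) ⟩
      ι μ               ∎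

  sameVertex⇔quotUnit : ∀ n {u₁ u₂} → 𝒪[ 0 ]ˣ u₁ → 𝒪[ 0 ]ˣ u₂ →
                        SameVertex n u₁ u₂ ⇔ QuotUnit n u₁ u₂
  sameVertex⇔quotUnit n 𝒪ˣu₁ 𝒪ˣu₂@(_ , v₂ , _ , u₂v₂≈1) =
    mk⇔ (sameVertex⇒quotUnit n 𝒪ˣu₁ 𝒪ˣu₂) (quotUnit⇒sameVertex n (v₂ , u₂v₂≈1))

theorem5p24 : ∀ {c ℓ} (K : NALocalField c ℓ) (t s : NALocalField.Carrier K) →
    UnramifiedData K t s →
    (n d : ℕ) → 1 ≤ n → d < n →
    ((u₁ u₂ : Ext.L K t s) →
      Ext.𝒪[_]ˣ K t s (n ∸ d) u₁ → Ext.𝒪[_]ˣ K t s (n ∸ d) u₂ →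
      (Ext.SameVertex K t s n u₁ u₂ ⇔ Ext.QuotUnit K t s n u₁ u₂))
    ×
    ((l : ℕ) (u : Fin l → Ext.L K t s) →
      Ext.Representatives K t s (n ∸ d) n l u →
      ∀ i j → ¬ (i ≡ j) → ¬ Ext.SameVertex K t s n (u i) (u j))
theorem5p24 K t s (𝒪-t , 𝒪-s , _) n d _ _ =
  (λ u₁ u₂ 𝒪ˣu₁ 𝒪ˣu₂ → sameVertex⇔quotUnit n (unit 𝒪ˣu₁) (unit 𝒪ˣu₂)) ,
  λ l u (𝒪ˣu , distinct , _) i j i≢j sameVertex →
    i≢j (distinct i j (sameVertex⇒quotUnit n (unit (𝒪ˣu i)) (unit (𝒪ˣu j)) sameVertex))
  where
  open Ext K t s using (𝒪[_]ˣ)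
  open Lattices K t s 𝒪-t 𝒪-s
  open Orders K t s 𝒪-t 𝒪-s using (𝒪[]ˣ⊆𝒪[0]ˣ)
  unit : ∀ {x} → 𝒪[ n ∸ d ]ˣ x → 𝒪[ 0 ]ˣ x
  unit = 𝒪[]ˣ⊆𝒪[0]ˣ (n ∸ d)
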